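{- Let $\Gamma$ be the graph on vertices $v_0,\dots,v_{19}$ (indices mod $20$) which is the edge-disjoint union of the Hamilton cycle $(v_0v_1\cdots v_{19})$, the pentagons $P_0=(v_0v_4v_8v_{12}v_{16})$, $P_1=(v_2v_6v_{10}v_{14}v_{18})$ and the pentagrams $Q_0=(v_1v_9v_{17}v_5v_{13})$, $Q_1=(v_3v_{11}v_{19}v_7v_{15})$, and let $F_0^0=\{v_0v_1,v_4v_5,v_8v_9,v_{12}v_{13},v_{16}v_{17}\}$, $F_0^1=\{v_0v_{19},v_4v_3,v_8v_7,v_{12}v_{11},v_{16}v_{15}\}$, $F_1^0=\{v_2v_1,v_6v_5,v_{10}v_9,v_{14}v_{13},v_{18}v_{17}\}$, $F_1^1=\{v_2v_3,v_6v_7,v_{10}v_{11},v_{14}v_{15},v_{18}v_{19}\}$, so that the four subgraphs $P_i\cup Q_j\cup F_i^j$ ($i,j\in\{0,1\}$) are copies of the Petersen graph. Then there exists a double cover $\Lambda$ of $\Gamma$ in which each of these four copies of the Petersen graph is covered by a copy of the dodecahedral graph. $\Lambda$ is a $40$-vertex $4$-regular graph of girth $5$ having exactly $64$ cycles of length $5$. Moreover, $\Lambda$ has a total coloring with colors $\{0,1,2,3,4\}$ that is not efficient and under which exactly $24$ of its $5$-cycles have both their vertex set and their edge set in bijective correspondence with $\{0,1,2,3,4\}$; the remaining $40$ five-cycles do not.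
   Context: A double cover of a graph $\Gamma$ is a graph $\Lambda$ with a surjective graph homomorphism $\Lambda\to\Gamma$ that is $2$-to-$1$ on vertices and maps the neighborhood of each vertex bijectively onto the neighborhood of its image; a subgraph $H$ of $\Gamma$ is covered by its preimage. A total coloring assigns colors to vertices and edges so that adjacent vertices, edges sharing an endpoint, and an edge and its endpoints receive different colors. For a connected $k$-regular graph (here $k=4$), a total coloring with colors $\{0,\dots,k\}$ is efficient if for every vertex $v$ the vertices of $N[v]$ receive pairwise distinct colors and each vertex color class is an efficient dominating set (independent set $S$ such that every vertex outside $S$ has exactly one neighbor in $S$). -}

module Defs where

open import Data.Bool using (Bool; true; false; _∧_; _∨_; if_then_else_)
open import Data.Nat using (ℕ; zero; suc; _+_; _≡ᵇ_; _≤_; _<_; _%_)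
open import Data.Nat.DivMod using (_mod_)
open import Data.Fin using (Fin; toℕ; _≟_)
import Data.Fin as F
open import Data.List using (List; []; _∷_; _++_; map; upTo)
open import Data.Bool.ListAction using (any)
open import Data.Vec using (Vec; lookup)
open import Data.Product using (Σ; _×_; _,_; proj₁; proj₂; ∃)
open import Data.Sum using (_⊎_)
open import Function using (_∘_)
open import Function.Definitions using (Injective)
open import Relation.Binary.PropositionalEquality using (_≡_; _≢_)
open import Relation.Nullary using (¬_)
open import Relation.Nullary.Decidable using (⌊_⌋)

AdjFn : ℕ → Set
AdjFn n = Fin n → Fin n → Bool

IsSimple : ∀ {n} → AdjFn n → Set
IsSimple {n} A = (∀ (x y : Fin n) → A x y ≡ A y x) × (∀ (x : Fin n) → A x x ≡ false)

count : ∀ {n} → (Fin n → Bool) → ℕ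
count {zero} f = 0
count {suc n} f = (if f F.zero then 1 else 0) + count (f ∘ F.suc)

Regular : ∀ {n} → AdjFn n → ℕ → Set
Regular A k = ∀ x → count (A x) ≡ k

Edge : Set
Edge = ℕ × ℕ

pathEdges : List ℕ → List Edge
pathEdges (a ∷ b ∷ r) = (a , b) ∷ pathEdges (b ∷ r)
pathEdges _ = []

cycleEdges : List ℕ → List Edge
cycleEdges [] = []
cycleEdges (a ∷ r) = pathEdges (a ∷ r ++ a ∷ [])

fromEdges : (n : ℕ) → List Edge → AdjFn n
fromEdges n es i j =
  any (λ e → ((toℕ i ≡ᵇ proj₁ e) ∧ (toℕ j ≡ᵇ proj₂ e)) ∨ ((toℕ j ≡ᵇ proj₁ e) ∧ (toℕ i ≡ᵇ proj₂ e))) es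

memberℕ : ∀ {n} → List ℕ → Fin n → Bool
memberℕ vs i = any (λ v → toℕ i ≡ᵇ v) vs

hamilton : List Edge
hamilton = cycleEdges (upTo 20)

Pverts : Bool → List ℕ
Pverts false = 0 ∷ 4 ∷ 8 ∷ 12 ∷ 16 ∷ []
Pverts true  = 2 ∷ 6 ∷ 10 ∷ 14 ∷ 18 ∷ []

-- listed in cyclic order as in the paper
Qverts : Bool → List ℕ
Qverts false = 1 ∷ 9 ∷ 17 ∷ 5 ∷ 13 ∷ []
Qverts true  = 3 ∷ 11 ∷ 19 ∷ 7 ∷ 15 ∷ []

Pedges : Bool → List Edge
Pedges i = cycleEdges (Pverts i)

Qedges : Bool → List Edge
Qedges j = cycleEdges (Qverts j)

-- F_i^j   (false ↔ index 0, true ↔ index 1)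
Fedges : Bool → Bool → List Edge
Fedges false false = (0 , 1) ∷ (4 , 5) ∷ (8 , 9) ∷ (12 , 13) ∷ (16 , 17) ∷ []
Fedges false true  = (0 , 19) ∷ (4 , 3) ∷ (8 , 7) ∷ (12 , 11) ∷ (16 , 15) ∷ []
Fedges true  false = (2 , 1) ∷ (6 , 5) ∷ (10 , 9) ∷ (14 , 13) ∷ (18 , 17) ∷ []
Fedges true  true  = (2 , 3) ∷ (6 , 7) ∷ (10 , 11) ∷ (14 , 15) ∷ (18 , 19) ∷ []

Γ : AdjFn 20
Γ = fromEdges 20 (hamilton ++ Pedges false ++ Pedges true ++ Qedges false ++ Qedges true)

petVerts : Bool → Bool → Fin 20 → Bool
petVerts i j = memberℕ (Pverts i ++ Qverts j)

petAdj : Bool → Bool → AdjFn 20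
petAdj i j = fromEdges 20 (Pedges i ++ Qedges j ++ Fedges i j)

-- The dodecahedral graph, as the generalized Petersen graph GP(10,2):
-- outer 10-cycle u_0..u_9 (vertices 0..9), spokes u_i w_i (w_i = 10+i),
-- inner edges w_i w_{i+2 mod 10}.

dodecahedron : AdjFn 20
dodecahedron = fromEdges 20
  (cycleEdges (upTo 10)
   ++ map (λ i → (i , 10 + i)) (upTo 10)
   ++ map (λ i → (10 + i , 10 + ((i + 2) % 10))) (upTo 10))

record IsDoubleCover {m n : ℕ} (L : AdjFn m) (G : AdjFn n) (p : Fin m → Fin n) : Set where
  field
    simple      : IsSimple L
    twoToOne    : ∀ v → count (λ x → ⌊ p x ≟ v ⌋) ≡ 2
    hom         : ∀ x y → L x y ≡ true → G (p x) (p y) ≡ true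
    localInj    : ∀ x y z → L x y ≡ true → L x z ≡ true → p y ≡ p z → y ≡ z
    localSurj   : ∀ x w → G (p x) w ≡ true → ∃ λ y → L x y ≡ true × p y ≡ w

-- The preimage under p of the subgraph H = (HV, HE) of G (vertices
-- p⁻¹(HV), edges of L lying over edges of H) is isomorphic to D.
PreimageIso : ∀ {m n k} (L : AdjFn m) (p : Fin m → Fin n)
  (HV : Fin n → Bool) (HE : AdjFn n) (D : AdjFn k) → Set
PreimageIso {m} {n} {k} L p HV HE D =
  Σ (Fin k → Fin m) λ φ →
    Injective _≡_ _≡_ φ
    × (∀ a → HV (p (φ a)) ≡ true)
    × (∀ x → HV (p x) ≡ true → ∃ λ a → φ a ≡ x)
    × (∀ a b → D a b ≡ (L (φ a) (φ b) ∧ HE (p (φ a)) (p (φ b))))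

next : ∀ {k} → Fin k → Fin k
next {suc k} i = suc (toℕ i) mod (suc k)

HasCycle : ∀ {n} → AdjFn n → ℕ → Set
HasCycle {n} A k = Σ (Fin k → Fin n) λ f →
  Injective _≡_ _≡_ f × (∀ i → A (f i) (f (next i)) ≡ true)

Girth : ∀ {n} → AdjFn n → ℕ → Set
Girth A g = 3 ≤ g × HasCycle A g × (∀ k → 3 ≤ k → k < g → ¬ HasCycle A k)

EdgeSet : ℕ → Set
EdgeSet n = Vec (Vec Bool n) n

memE : ∀ {n} → EdgeSet n → Fin n → Fin n → Bool
memE M i j = lookup (lookup M i) j

CycEdge : ∀ {n k} → (Fin k → Fin n) → Fin n → Fin n → Set
CycEdge f i j = ∃ λ t → (f t ≡ i × f (next t) ≡ j) ⊎ (f t ≡ j × f (next t) ≡ i)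

Traverses : ∀ {n} → AdjFn n → EdgeSet n → (Fin 5 → Fin n) → Set
Traverses A M f =
  Injective _≡_ _≡_ f
  × (∀ t → A (f t) (f (next t)) ≡ true)
  × (∀ i j → (memE M i j ≡ true → CycEdge f i j) × (CycEdge f i j → memE M i j ≡ true))

-- M is (the edge set of) a 5-cycle of A; 5-cycles are identified with
-- their edge sets
IsFiveCycle : ∀ {n} → AdjFn n → EdgeSet n → Set
IsFiveCycle A M = Σ _ (Traverses A M)

ExactlyN : {A : Set} → (A → Set) → ℕ → Set
ExactlyN {A} P N = Σ (Fin N → A) λ f →
  Injective _≡_ _≡_ f × (∀ i → P (f i)) × (∀ a → P a → ∃ λ i → f i ≡ a)

record TotalColouring {n : ℕ} (A : AdjFn n) (c : ℕ) : Set where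
  field
    vc : Fin n → Fin c
    ec : Fin n → Fin n → Fin c          -- only values on edges matter
    ec-sym    : ∀ x y → A x y ≡ true → ec x y ≡ ec y x
    v-proper  : ∀ x y → A x y ≡ true → vc x ≢ vc y
    e-proper  : ∀ x y z → A x y ≡ true → A x z ≡ true → y ≢ z → ec x y ≢ ec x z
    ve-proper : ∀ x y → A x y ≡ true → ec x y ≢ vc x

open TotalColouring public

IsEDS : ∀ {n} → AdjFn n → (Fin n → Bool) → Set
IsEDS A S =
  (∀ x y → S x ≡ true → S y ≡ true → A x y ≡ false)
  × (∀ x → S x ≡ false → count (λ y → A x y ∧ S y) ≡ 1)

ClosedNbr : ∀ {n} → AdjFn n → Fin n → Fin n → Set
ClosedNbr A v x = x ≡ v ⊎ A v x ≡ true

Efficient : ∀ {n c} {A : AdjFn n} → TotalColouring A c → Set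
Efficient {n} {c} {A} τ =
  (∀ v x y → ClosedNbr A v x → ClosedNbr A v y → x ≢ y → vc τ x ≢ vc τ y)
  × (∀ (col : Fin c) → IsEDS A (λ x → ⌊ vc τ x ≟ col ⌋))

Rainbow : ∀ {n} {A : AdjFn n} → TotalColouring A 5 → EdgeSet n → Set
Rainbow {n} {A} τ M = Σ (Fin 5 → Fin n) λ f →
  Traverses A M f
  × Injective _≡_ _≡_ (vc τ ∘ f)
  × Injective _≡_ _≡_ (λ t → ec τ (f t) (f (next t)))

module Submission where

-- Λ is the Z₂-voltage lift of Γ with voltage 1 exactly on the pentagram edges, which are the
-- edges of Γ joining two odd vertices: every vertex of Γ has a copy on each of two sheets, and
-- every edge of Γ lifts to two edges that keep or swap the sheets according to its voltage.
-- Every voltage lift is a double cover. Over a Petersen copy P_i ∪ Q_j ∪ F_i^j only the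
-- pentagram carries voltage 1, so the pentagon lifts to two pentagons, the pentagram to a
-- 10-cycle, and the spokes join them: the dodecahedron. The remaining claims concern one
-- finite graph and are decided by evaluation: short cycles by enumerating walks along
-- neighbour tables, and 5-cycles by matching every closed 5-walk with one of 64 listed cycles.
-- Whether a 5-cycle is rainbow does not depend on how it is traversed, so the rainbow
-- 5-cycles are counted on the listed traversals.

open import Defs
open import Level using (0ℓ)
open import Data.Bool using (Bool; true; false; _∧_; _xor_; if_then_else_)
open import Data.Bool.Properties using (∧-comm; ∧-conicalˡ; xor-comm; xor-assoc; xor-same)
import Data.Bool.Properties as Bool
open import Data.Empty using (⊥-elim)
open import Data.Fin using (Fin; zero; suc; #_; toℕ; splitAt; _↑ˡ_; _↑ʳ_; join)
open import Data.Fin.Properties using (_≟_; suc-injective; all?; any?; splitAt-↑ˡ; splitAt-↑ʳ; join-splitAt)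
open import Data.List using (List; []; _∷_; length; lookup; filter; allFin)
open import Data.List.Membership.Propositional.Properties using (∈-filter⁺; ∈-filter⁻; ∈-allFin; ∈-lookup)
import Data.List.Relation.Unary.All as All
open import Data.List.Relation.Unary.Any using (index)
open import Data.List.Relation.Unary.Any.Properties using (lookup-index)
open import Data.List.Relation.Unary.Unique.Propositional using (Unique; _∷_)
open import Data.List.Relation.Unary.Unique.Propositional.Properties using (allFin⁺; filter⁺)
open import Data.Nat using (ℕ; zero; suc; _+_; _∸_; _%_; _≡ᵇ_; _≤_; _<_; s≤s; z≤n)
import Data.Nat.Properties as ℕ
open import Data.Nat.DivMod using (_mod_)
open import Data.Product using (Σ; _×_; _,_; proj₁; proj₂; ∃)
open import Data.Sum using (_⊎_; inj₁; inj₂; [_,_]′)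
open import Data.Unit using (⊤)
open import Data.Vec using (Vec; _∷_; []; tabulate)
import Data.Vec as Vec
open import Data.Vec.Properties using (lookup∘tabulate; tabulate∘lookup; tabulate-cong)
open import Function using (_∘_; id; const; _⇔_; mk⇔; Equivalence)
open import Function.Definitions using (Injective)
open import Function.Related.TypeIsomorphisms using (¬-cong-⇔)
open import Relation.Binary.PropositionalEquality using (_≡_; _≢_; refl; sym; trans; cong; cong₂; subst; _≗_; module ≡-Reasoning)
open import Relation.Nullary using (¬_; Dec; yes; no; does; ¬?)
open import Relation.Nullary.Decidable using (⌊_⌋; ⌊⌋-map′; map′; dec-true; _×-dec_; _⊎-dec_; _→-dec_)
open import Relation.Unary using (Pred; Decidable)

private variable
  m n d k l N : ℕ

injective? : (f : Fin m → Fin n) → Dec (Injective _≡_ _≡_ f)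
injective? f = map′ (λ h {i} {j} → h i j) (λ h i j → h) (all? λ i → all? λ j → (f i ≟ f j) →-dec (i ≟ j))

Injective-≗ : ∀ {A B : Set} {f g : A → B} → f ≗ g → Injective _≡_ _≡_ f → Injective _≡_ _≡_ g
Injective-≗ f≗g f-inj {i} {j} e = f-inj (trans (f≗g i) (trans e (sym (f≗g j))))

-- Unlike from-yes, only the Boolean part of P? is evaluated, which keeps large decisions within memory.
decide : ∀ {P : Set} (P? : Dec P) → does P? ≡ true → P
decide (yes p) _ = p

≡does : ∀ {b} {P : Set} → (b ≡ true → P) × (P → b ≡ true) → (P? : Dec P) → b ≡ does P?
≡does {false} (_ , from) (yes p) = from p
≡does {false} _          (no _)  = refl
≡does {true}  _          (yes _) = refl
≡does {true}  (to , _)   (no ¬p) = ⊥-elim (¬p (to refl))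

count-cong : {f g : Fin n → Bool} → f ≗ g → count f ≡ count g
count-cong {zero}  f≗g = refl
count-cong {suc n} f≗g = cong₂ _+_ (cong (λ b → if b then 1 else 0) (f≗g zero)) (count-cong (f≗g ∘ suc))

count-false : count {n} (const false) ≡ 0
count-false {zero}  = refl
count-false {suc n} = count-false {n}

count-↑ : ∀ m (f : Fin (m + n) → Bool) → count f ≡ count (f ∘ (_↑ˡ n)) + count (f ∘ (m ↑ʳ_))
count-↑ zero    f = refl
count-↑ (suc m) f = trans (cong ((if f zero then 1 else 0) +_) (count-↑ m (f ∘ suc)))
                          (sym (ℕ.+-assoc (if f zero then 1 else 0) _ _))

count-≟ : (v : Fin n) → count (λ u → ⌊ u ≟ v ⌋) ≡ 1
count-≟ {suc n} zero    = cong suc (count-false {n})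
count-≟ {suc n} (suc v) = trans (count-cong λ u → ⌊⌋-map′ (cong suc) suc-injective (u ≟ v)) (count-≟ v)

lookup-injective : ∀ {A : Set} {xs : List A} → Unique xs → Injective _≡_ _≡_ (lookup xs)
lookup-injective {xs = x ∷ xs} (x∉xs ∷ u) {zero}  {zero}  _ = refl
lookup-injective {xs = x ∷ xs} (x∉xs ∷ u) {zero}  {suc j} e = ⊥-elim (All.lookup x∉xs (∈-lookup j) e)
lookup-injective {xs = x ∷ xs} (x∉xs ∷ u) {suc i} {zero}  e = ⊥-elim (All.lookup x∉xs (∈-lookup i) (sym e))
lookup-injective {xs = x ∷ xs} (x∉xs ∷ u) {suc i} {suc j} e = cong suc (lookup-injective u e)

ExactlyN-filter : ∀ {P : Pred (Fin N) 0ℓ} (P? : Decidable P) → ExactlyN P (length (filter P? (allFin N)))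
ExactlyN-filter {N} P? = lookup xs , lookup-injective (filter⁺ P? (allFin⁺ N)) , satisfies , listed
  where
  xs = filter P? (allFin N)
  satisfies = λ i → proj₂ (∈-filter⁻ P? {xs = allFin N} (∈-lookup i))
  listed : ∀ a → _ → ∃ λ i → lookup xs i ≡ a
  listed a pa = let a∈xs = ∈-filter⁺ P? (∈-allFin a) pa in index a∈xs , sym (lookup-index a∈xs)

ExactlyN-⇔ : ∀ {A : Set} {P Q : A → Set} → (∀ a → P a ⇔ Q a) → ExactlyN P N → ExactlyN Q N
ExactlyN-⇔ P⇔Q (e , e-inj , e-P , e-cover) =
  e , e-inj , (λ i → Equivalence.to (P⇔Q (e i)) (e-P i)) , (λ a → e-cover a ∘ Equivalence.from (P⇔Q a))

ExactlyN-∩ : ∀ {A : Set} {P Q : A → Set} (P-enum : ExactlyN P N) →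
             ExactlyN (Q ∘ proj₁ P-enum) m → ExactlyN (λ a → P a × Q a) m
ExactlyN-∩ (e , e-inj , e-P , e-cover) (s , s-inj , s-Q , s-cover) =
  e ∘ s , s-inj ∘ e-inj , (λ j → e-P (s j) , s-Q j) , listed
  where
  listed : ∀ a → _ → ∃ λ j → e (s j) ≡ a
  listed a (pa , qa) with e-cover a pa
  ... | i , refl with s-cover i qa
  ...   | j , refl = j , refl

-- Voltage lifts

xor-cancelˡ : ∀ a b → a xor (a xor b) ≡ b
xor-cancelˡ a b = trans (sym (xor-assoc a a b)) (cong (_xor b) (xor-same a))

xor-injectiveʳ : ∀ a {b c} → a xor b ≡ a xor c → b ≡ c
xor-injectiveʳ a {b} {c} e = trans (sym (xor-cancelˡ a b)) (trans (cong (a xor_) e) (xor-cancelˡ a c))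

ListsNeighbours : AdjFn n → (Fin n → Fin d → Fin n) → Set
ListsNeighbours A nb = ∀ x y → A x y ≡ true → ∃ λ k → nb x k ≡ y

module Lift (G σ : AdjFn n) where

  open ≡-Reasoning

  base : Fin (n + n) → Fin n
  base x = [ id , id ]′ (splitAt n x)

  sheet : Fin (n + n) → Bool
  sheet x = [ const false , const true ]′ (splitAt n x)

  vertex : Bool → Fin n → Fin (n + n)
  vertex false v = v ↑ˡ n
  vertex true  v = n ↑ʳ v

  base-vertex : ∀ s v → base (vertex s v) ≡ v
  base-vertex false v = cong [ id , id ]′ (splitAt-↑ˡ n v n)
  base-vertex true  v = cong [ id , id ]′ (splitAt-↑ʳ n n v)

  sheet-vertex : ∀ s v → sheet (vertex s v) ≡ s
  sheet-vertex false v = cong [ const false , const true ]′ (splitAt-↑ˡ n v n)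
  sheet-vertex true  v = cong [ const false , const true ]′ (splitAt-↑ʳ n n v)

  vertex-sheet-base : ∀ x → vertex (sheet x) (base x) ≡ x
  vertex-sheet-base x = go (splitAt n x) (join-splitAt n n x)
    where
    go : ∀ s → join n n s ≡ x → vertex ([ const false , const true ]′ s) ([ id , id ]′ s) ≡ x
    go (inj₁ v) e = e
    go (inj₂ v) e = e

  lift : AdjFn (n + n)
  lift x y = G (base x) (base y) ∧ does (sheet x xor sheet y Bool.≟ σ (base x) (base y))

  lift-hom : ∀ x y → lift x y ≡ true → G (base x) (base y) ≡ true
  lift-hom x y = ∧-conicalˡ _ _

  lift-voltage : ∀ x y → lift x y ≡ true → sheet x xor sheet y ≡ σ (base x) (base y)
  lift-voltage x y xy with G (base x) (base y) | sheet x xor sheet y Bool.≟ σ (base x) (base y)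
  ... | true | yes e = e

  lift-adjacent : ∀ x y → G (base x) (base y) ≡ true → sheet x xor sheet y ≡ σ (base x) (base y) → lift x y ≡ true
  lift-adjacent x y g e rewrite g | e = ≟-diag (σ (base x) (base y))
    where
    ≟-diag : ∀ b → does (b Bool.≟ b) ≡ true
    ≟-diag false = refl
    ≟-diag true  = refl

  lift-over : ∀ x w → G (base x) w ≡ true → lift x (vertex (sheet x xor σ (base x) w) w) ≡ true
  lift-over x w g = lift-adjacent x y (subst (λ v → G (base x) v ≡ true) (sym (base-vertex s w)) g) voltage
    where
    s = sheet x xor σ (base x) w
    y = vertex s w
    voltage : sheet x xor sheet y ≡ σ (base x) (base y)
    voltage = begin
      sheet x xor sheet y  ≡⟨ cong (sheet x xor_) (sheet-vertex s w) ⟩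
      sheet x xor s        ≡⟨ xor-cancelˡ (sheet x) _ ⟩
      σ (base x) w         ≡⟨ cong (σ (base x)) (sym (base-vertex s w)) ⟩
      σ (base x) (base y)  ∎

  lift-isDoubleCover : IsSimple G → (∀ v w → σ v w ≡ σ w v) → IsDoubleCover lift G base
  lift-isDoubleCover (G-sym , G-loopless) σ-sym = record
    { simple    = lift-sym , λ x → cong (_∧ does (sheet x xor sheet x Bool.≟ σ (base x) (base x))) (G-loopless (base x))
    ; twoToOne  = fibre
    ; hom       = lift-hom
    ; localInj  = localInj
    ; localSurj = λ x w g → vertex (sheet x xor σ (base x) w) w , lift-over x w g , base-vertex (sheet x xor σ (base x) w) w
    }
    where
    lift-sym : ∀ x y → lift x y ≡ lift y x
    lift-sym x y = cong₂ _∧_ (G-sym (base x) (base y))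
      (cong₂ (λ a b → does (a Bool.≟ b)) (xor-comm (sheet x) (sheet y)) (σ-sym (base x) (base y)))

    localInj : ∀ x y z → lift x y ≡ true → lift x z ≡ true → base y ≡ base z → y ≡ z
    localInj x y z xy xz by≡bz = begin
      y                          ≡⟨ vertex-sheet-base y ⟨
      vertex (sheet y) (base y)  ≡⟨ cong₂ vertex sy≡sz by≡bz ⟩
      vertex (sheet z) (base z)  ≡⟨ vertex-sheet-base z ⟩
      z                          ∎
      where
      sy≡sz = xor-injectiveʳ (sheet x)
        (trans (lift-voltage x y xy) (trans (cong (σ (base x)) by≡bz) (sym (lift-voltage x z xz))))

    fibre : ∀ v → count (λ x → ⌊ base x ≟ v ⌋) ≡ 2
    fibre v = begin
      count (λ x → ⌊ base x ≟ v ⌋)                         ≡⟨ count-↑ n _ ⟩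
      count (λ u → ⌊ base (vertex false u) ≟ v ⌋)
        + count (λ u → ⌊ base (vertex true u) ≟ v ⌋)       ≡⟨ cong₂ _+_ (on-sheet false) (on-sheet true) ⟩
      count (λ u → ⌊ u ≟ v ⌋) + count (λ u → ⌊ u ≟ v ⌋)   ≡⟨ cong₂ _+_ (count-≟ v) (count-≟ v) ⟩
      2                                                    ∎
      where
      on-sheet : ∀ s → count (λ u → ⌊ base (vertex s u) ≟ v ⌋) ≡ count (λ u → ⌊ u ≟ v ⌋)
      on-sheet s = count-cong λ u → cong (λ b → ⌊ b ≟ v ⌋) (base-vertex s u)

  liftNeighbour : (Fin n → Fin d → Fin n) → Fin (n + n) → Fin d → Fin (n + n)
  liftNeighbour nb x k = vertex (sheet x xor σ (base x) w) w
    where w = nb (base x) k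

  lift-listsNeighbours : {nb : Fin n → Fin d → Fin n} → ListsNeighbours G nb → ListsNeighbours lift (liftNeighbour nb)
  lift-listsNeighbours {nb = nb} lists x y xy with lists (base x) (base y) (lift-hom x y xy)
  ... | k , nb≡by = k , (begin
    vertex (sheet x xor σ (base x) (nb (base x) k)) (nb (base x) k)
      ≡⟨ cong (λ v → vertex (sheet x xor σ (base x) v) v) nb≡by ⟩
    vertex (sheet x xor σ (base x) (base y)) (base y)
      ≡⟨ cong (λ s → vertex (sheet x xor s) (base y)) (lift-voltage x y xy) ⟨
    vertex (sheet x xor (sheet x xor sheet y)) (base y)
      ≡⟨ cong (λ s → vertex s (base y)) (xor-cancelˡ (sheet x) (sheet y)) ⟩
    vertex (sheet y) (base y)
      ≡⟨ vertex-sheet-base y ⟩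
    y ∎)

PreimageIsoVia : ∀ {k} → AdjFn m → (Fin m → Fin n) → (Fin n → Bool) → AdjFn n → AdjFn k → (Fin k → Fin m) → Set
PreimageIsoVia L p HV HE D φ =
  Injective _≡_ _≡_ φ
  × (∀ a → HV (p (φ a)) ≡ true)
  × (∀ x → HV (p x) ≡ true → ∃ λ a → φ a ≡ x)
  × (∀ a b → D a b ≡ (L (φ a) (φ b) ∧ HE (p (φ a)) (p (φ b))))

preimageIsoVia? : ∀ {k} (L : AdjFn m) (p : Fin m → Fin n) (HV : Fin n → Bool) (HE : AdjFn n) (D : AdjFn k)
                  (φ : Fin k → Fin m) → Dec (PreimageIsoVia L p HV HE D φ)
preimageIsoVia? L p HV HE D φ =
  injective? φ
  ×-dec all? (λ a → HV (p (φ a)) Bool.≟ true)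
  ×-dec all? (λ x → (HV (p x) Bool.≟ true) →-dec any? λ a → φ a ≟ x)
  ×-dec all? (λ a → all? λ b → D a b Bool.≟ (L (φ a) (φ b) ∧ HE (p (φ a)) (p (φ b))))

-- Walks along a neighbour table

module _ {A : AdjFn n} {nb : Fin n → Fin d → Fin n} (lists : ListsNeighbours A nb) where

  ∀-adjacent : {R : Fin n → Fin n → Set} → (∀ x k → R x (nb x k)) → ∀ x y → A x y ≡ true → R x y
  ∀-adjacent h x y xy with lists x y xy
  ... | k , refl = h x k

  ∀-adjacent₂ : {R : Fin n → Fin n → Fin n → Set} → (∀ x k l → R x (nb x k) (nb x l)) →
                ∀ x y z → A x y ≡ true → A x z ≡ true → R x y z
  ∀-adjacent₂ h x y z xy xz with lists x y xy | lists x z xz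
  ... | k , refl | l , refl = h x k l

IsWalk : AdjFn n → Vec (Fin n) (suc k) → Set
IsWalk A (x ∷ [])    = ⊤
IsWalk A (x ∷ y ∷ w) = A x y ≡ true × IsWalk A (y ∷ w)

EveryWalkFrom : (Fin n → Fin d → Fin n) → ∀ k → (Vec (Fin n) (suc k) → Set) → Fin n → Set
EveryWalkFrom nb zero    P x = P (x ∷ [])
EveryWalkFrom nb (suc k) P x = ∀ i → EveryWalkFrom nb k (P ∘ (x ∷_)) (nb x i)

everyWalkFrom? : (nb : Fin n → Fin d → Fin n) → ∀ k {P : Vec (Fin n) (suc k) → Set} → Decidable P →
                 Decidable (EveryWalkFrom nb k P)
everyWalkFrom? nb zero    P? x = P? (x ∷ [])
everyWalkFrom? nb (suc k) P? x = all? λ i → everyWalkFrom? nb k (P? ∘ (x ∷_)) (nb x i)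

everyWalkFrom-sound : {A : AdjFn n} {nb : Fin n → Fin d → Fin n} → ListsNeighbours A nb →
                      {P : Vec (Fin n) (suc k) → Set} (w : Vec (Fin n) (suc k)) → IsWalk A w → EveryWalkFrom nb k P (Vec.head w) → P w
everyWalkFrom-sound lists (x ∷ [])    _           h = h
everyWalkFrom-sound lists (x ∷ y ∷ w) (xy , walk) h with lists x y xy
... | i , refl = everyWalkFrom-sound lists (y ∷ w) walk (h i)

InRow : (Fin n → Fin d → Fin n) → Fin n → Fin n → Set
InRow nb x y = ∃ λ i → nb x i ≡ y

inRow? : (nb : Fin n → Fin d → Fin n) → ∀ x y → Dec (InRow nb x y)
inRow? nb x y = any? λ i → nb x i ≟ y

NoTriangleAt : (Fin n → Fin d → Fin n) → Vec (Fin n) 3 → Set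
NoTriangleAt nb (a ∷ b ∷ c ∷ []) = InRow nb c a → c ≡ a

noTriangleAt? : (nb : Fin n → Fin d → Fin n) → Decidable (NoTriangleAt nb)
noTriangleAt? nb (a ∷ b ∷ c ∷ []) = inRow? nb c a →-dec (c ≟ a)

NoSquareAt : (Fin n → Fin d → Fin n) → Vec (Fin n) 4 → Set
NoSquareAt nb (a ∷ b ∷ c ∷ d ∷ []) = InRow nb d a → c ≡ a ⊎ d ≡ b

noSquareAt? : (nb : Fin n → Fin d → Fin n) → Decidable (NoSquareAt nb)
noSquareAt? nb (a ∷ b ∷ c ∷ d ∷ []) = inRow? nb d a →-dec ((c ≟ a) ⊎-dec (d ≟ b))

module _ {A : AdjFn n} {nb : Fin n → Fin d → Fin n} (lists : ListsNeighbours A nb) where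

  no-3-cycle : (∀ x → EveryWalkFrom nb 2 (NoTriangleAt nb) x) → ¬ HasCycle A 3
  no-3-cycle h (f , f-inj , adj) = ((λ ()) ∘ f-inj) (triangle (lists _ _ (adj (# 2))))
    where triangle = everyWalkFrom-sound lists {P = NoTriangleAt nb} (tabulate f) (adj (# 0) , adj (# 1) , _) (h (f (# 0)))

  no-4-cycle : (∀ x → EveryWalkFrom nb 3 (NoSquareAt nb) x) → ¬ HasCycle A 4
  no-4-cycle h (f , f-inj , adj) = [ (λ ()) ∘ f-inj , (λ ()) ∘ f-inj ]′ (square (lists _ _ (adj (# 3))))
    where square = everyWalkFrom-sound lists {P = NoSquareAt nb} (tabulate f) (adj (# 0) , adj (# 1) , adj (# 2) , _) (h (f (# 0)))

girth-5 : {A : AdjFn n} → HasCycle A 5 → ¬ HasCycle A 3 → ¬ HasCycle A 4 → Girth A 5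
girth-5 {A = A} c5 ¬c3 ¬c4 = s≤s (s≤s (s≤s z≤n)) , c5 , shorter
  where
  shorter : ∀ k → 3 ≤ k → k < 5 → ¬ HasCycle A k
  shorter 0 () _
  shorter 1 (s≤s ()) _
  shorter 2 (s≤s (s≤s ())) _
  shorter 3 _ _ = ¬c3
  shorter 4 _ _ = ¬c4
  shorter (suc (suc (suc (suc (suc _))))) _ (s≤s (s≤s (s≤s (s≤s (s≤s ())))))

-- Cycles and their edge sets

CycEdge-sym : {f : Fin k → Fin n} {i j : Fin n} → CycEdge f i j → CycEdge f j i
CycEdge-sym (t , inj₁ e) = t , inj₂ e
CycEdge-sym (t , inj₂ e) = t , inj₁ e

CycEdge-≗ : {f g : Fin k → Fin n} {i j : Fin n} → f ≗ g → CycEdge f i j → CycEdge g i j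
CycEdge-≗ f≗g (t , inj₁ (p , q)) = t , inj₁ (trans (sym (f≗g t)) p , trans (sym (f≗g (next t))) q)
CycEdge-≗ f≗g (t , inj₂ (p , q)) = t , inj₂ (trans (sym (f≗g t)) p , trans (sym (f≗g (next t))) q)

cycEdge? : (f : Fin k → Fin n) → ∀ i j → Dec (CycEdge f i j)
cycEdge? f i j = any? λ t → ((f t ≟ i) ×-dec (f (next t) ≟ j)) ⊎-dec ((f t ≟ j) ×-dec (f (next t) ≟ i))

EdgesWithin : (Fin k → Fin n) → (Fin l → Fin n) → Set
EdgesWithin f g = ∀ t → CycEdge g (f t) (f (next t))

edgesWithin? : (f : Fin k → Fin n) (g : Fin l → Fin n) → Dec (EdgesWithin f g)
edgesWithin? f g = all? λ t → cycEdge? g (f t) (f (next t))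

edgesWithin-⊆ : {f : Fin k → Fin n} {g : Fin l → Fin n} {i j : Fin n} → EdgesWithin f g → CycEdge f i j → CycEdge g i j
edgesWithin-⊆ f⊆g (t , inj₁ (refl , refl)) = f⊆g t
edgesWithin-⊆ f⊆g (t , inj₂ (refl , refl)) = CycEdge-sym (f⊆g t)

edgeSet : (Fin k → Fin n) → EdgeSet n
edgeSet f = tabulate λ i → tabulate λ j → does (cycEdge? f i j)

memE-edgeSet : ∀ (f : Fin k → Fin n) i j → memE (edgeSet f) i j ≡ does (cycEdge? f i j)
memE-edgeSet f i j = trans (cong (λ row → Vec.lookup row j) (lookup∘tabulate _ i)) (lookup∘tabulate _ j)

≡-edgeSet : {M : EdgeSet n} {f : Fin k → Fin n} →
            (∀ i j → (memE M i j ≡ true → CycEdge f i j) × (CycEdge f i j → memE M i j ≡ true)) → M ≡ edgeSet f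
≡-edgeSet {M = M} {f = f} M⇔f = trans (sym (tabulate∘lookup M)) (tabulate-cong λ i →
  trans (sym (tabulate∘lookup (Vec.lookup M i))) (tabulate-cong λ j → ≡does (M⇔f i j) (cycEdge? f i j)))

edgeSet-≡⇒edgesWithin : {f : Fin k → Fin n} {g : Fin l → Fin n} → edgeSet f ≡ edgeSet g → EdgesWithin f g
edgeSet-≡⇒edgesWithin {f = f} {g = g} f≡g t = decide (cycEdge? g _ _) (begin
  does (cycEdge? g (f t) (f (next t)))  ≡⟨ memE-edgeSet g _ _ ⟨
  memE (edgeSet g) (f t) (f (next t))   ≡⟨ cong (λ M → memE M (f t) (f (next t))) f≡g ⟨
  memE (edgeSet f) (f t) (f (next t))   ≡⟨ memE-edgeSet f _ _ ⟩
  does (cycEdge? f (f t) (f (next t)))  ≡⟨ dec-true (cycEdge? f _ _) (t , inj₁ (refl , refl)) ⟩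
  true                                  ∎)
  where open ≡-Reasoning

edgeSet-traversed : {A : AdjFn n} {f : Fin 5 → Fin n} → Injective _≡_ _≡_ f →
                    (∀ t → A (f t) (f (next t)) ≡ true) → Traverses A (edgeSet f) f
edgeSet-traversed {f = f} f-inj adj = f-inj , adj , λ i j →
  (λ m → decide (cycEdge? f i j) (trans (sym (memE-edgeSet f i j)) m)) ,
  (λ e → trans (memE-edgeSet f i j) (dec-true (cycEdge? f i j) e))

Listed : (Fin n → Fin d → Fin n) → (Fin N → Fin 5 → Fin n) → Vec (Fin n) 5 → Set
Listed nb cycle w@(a ∷ _ ∷ _ ∷ _ ∷ e ∷ []) =
  InRow nb e a → Injective _≡_ _≡_ (Vec.lookup w) →
  ∃ λ k → EdgesWithin (Vec.lookup w) (cycle k) × EdgesWithin (cycle k) (Vec.lookup w)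

listed? : (nb : Fin n → Fin d → Fin n) (cycle : Fin N → Fin 5 → Fin n) → Decidable (Listed nb cycle)
listed? nb cycle w@(a ∷ _ ∷ _ ∷ _ ∷ e ∷ []) =
  inRow? nb e a →-dec (injective? (Vec.lookup w) →-dec any? λ k →
    edgesWithin? (Vec.lookup w) (cycle k) ×-dec edgesWithin? (cycle k) (Vec.lookup w))

module FiveCycleTable
  {A : AdjFn n} {nb : Fin n → Fin d → Fin n} (lists : ListsNeighbours A nb)
  {cycle : Fin N → Fin 5 → Fin n} (cycle-inj : ∀ k → Injective _≡_ _≡_ (cycle k))
  (cycle-adj : ∀ k t → A (cycle k t) (cycle k (next t)) ≡ true) (distinct : ∀ k l → EdgesWithin (cycle k) (cycle l) → k ≡ l)
  (listed : ∀ x → EveryWalkFrom nb 4 (Listed nb cycle) x)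
  where

  traversal-listed : ∀ {M f} → Traverses A M f → ∃ λ k → M ≡ edgeSet (cycle k)
  traversal-listed {M} {f} (f-inj , adj , M⇔f) = found (everyWalkFrom-sound lists {P = Listed nb cycle} w
    (adj (# 0) , adj (# 1) , adj (# 2) , adj (# 3) , _) (listed (f (# 0))) (lists _ _ (adj (# 4))) (Injective-≗ (sym ∘ w≗f) f-inj))
    where
    w = tabulate f
    w≗f = lookup∘tabulate f
    found : ∃ (λ k → EdgesWithin (Vec.lookup w) (cycle k) × EdgesWithin (cycle k) (Vec.lookup w)) → ∃ λ k → M ≡ edgeSet (cycle k)
    found (k , w⊆k , k⊆w) = k , ≡-edgeSet λ i j →
      (λ m → edgesWithin-⊆ w⊆k (CycEdge-≗ (sym ∘ w≗f) (proj₁ (M⇔f i j) m))) ,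
      (λ e → proj₂ (M⇔f i j) (CycEdge-≗ w≗f (edgesWithin-⊆ k⊆w e)))

  cycle-traverses : ∀ k → Traverses A (edgeSet (cycle k)) (cycle k)
  cycle-traverses k = edgeSet-traversed {A = A} (cycle-inj k) (cycle-adj k)

  fiveCycles : ExactlyN (IsFiveCycle A) N
  fiveCycles =
    edgeSet ∘ cycle ,
    (λ k≡l → distinct _ _ (edgeSet-≡⇒edgesWithin k≡l)) ,
    (λ k → cycle k , cycle-traverses k) ,
    λ M (f , f-traverses) → let (k , M≡k) = traversal-listed f-traverses in k , sym M≡k

Colourful : ∀ {A : AdjFn n} {c} → TotalColouring A c → (Fin k → Fin n) → Set
Colourful τ f = Injective _≡_ _≡_ (vc τ ∘ f) × Injective _≡_ _≡_ (λ t → ec τ (f t) (f (next t)))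

colourful? : ∀ {A : AdjFn n} {c} (τ : TotalColouring A c) (f : Fin k → Fin n) → Dec (Colourful τ f)
colourful? τ f = injective? (vc τ ∘ f) ×-dec injective? (λ t → ec τ (f t) (f (next t)))

CycEdge-endpoint : {f : Fin k → Fin n} {i j : Fin n} → CycEdge f i j → ∃ λ s → f s ≡ i
CycEdge-endpoint (t , inj₁ (p , _)) = t , p
CycEdge-endpoint (t , inj₂ (_ , q)) = next t , q

next²≢id : (u : Fin 5) → next (next u) ≢ u
next²≢id zero ()
next²≢id (suc zero) ()
next²≢id (suc (suc zero)) ()
next²≢id (suc (suc (suc zero))) ()
next²≢id (suc (suc (suc (suc zero)))) ()

-- g runs through the vertices and edges of f, and meets no edge twice because next ∘ next has no
-- fixed point; so the colours that are distinct along f stay distinct along g.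
colourful-invariant : ∀ {A : AdjFn n} {c} (τ : TotalColouring A c) {M f g} →
                      Traverses A M f → Traverses A M g → Colourful τ f → Colourful τ g
colourful-invariant τ {f = f} {g = g} (f-inj , f-adj , M⇔f) (g-inj , _ , M⇔g) (fv-inj , fe-inj) = gv-inj , ge-inj
  where
  g⊆f : EdgesWithin g f
  g⊆f t = proj₁ (M⇔f _ _) (proj₂ (M⇔g _ _) (t , inj₁ (refl , refl)))

  gv-inj : Injective _≡_ _≡_ (vc τ ∘ g)
  gv-inj {i} {j} e with CycEdge-endpoint (g⊆f i) | CycEdge-endpoint (g⊆f j)
  ... | s , fs≡gi | s′ , fs′≡gj = g-inj (trans (sym fs≡gi) (trans (cong f (fv-inj colours)) fs′≡gj))
    where colours = trans (cong (vc τ) fs≡gi) (trans e (cong (vc τ) (sym fs′≡gj)))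

  onEdge : ∀ {s t} → (f s ≡ g t × f (next s) ≡ g (next t)) ⊎ (f s ≡ g (next t) × f (next s) ≡ g t) →
           ec τ (f s) (f (next s)) ≡ ec τ (g t) (g (next t))
  onEdge (inj₁ (p , q)) = cong₂ (ec τ) p q
  onEdge {s} (inj₂ (p , q)) = trans (ec-sym τ _ _ (f-adj s)) (cong₂ (ec τ) q p)

  sameEdge : ∀ {s t u} → (f s ≡ g t × f (next s) ≡ g (next t)) ⊎ (f s ≡ g (next t) × f (next s) ≡ g t) →
             (f s ≡ g u × f (next s) ≡ g (next u)) ⊎ (f s ≡ g (next u) × f (next s) ≡ g u) → t ≡ u
  sameEdge (inj₁ (p , _)) (inj₁ (p′ , _)) = g-inj (trans (sym p) p′)
  sameEdge (inj₂ (_ , q)) (inj₂ (_ , q′)) = g-inj (trans (sym q) q′)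
  sameEdge {u = u} (inj₁ (p , q)) (inj₂ (p′ , q′)) =
    ⊥-elim (next²≢id u (trans (cong next (g-inj (trans (sym p′) p))) (g-inj (trans (sym q) q′))))
  sameEdge {u = u} (inj₂ (p , q)) (inj₁ (p′ , q′)) =
    ⊥-elim (next²≢id u (trans (cong next (sym (g-inj (trans (sym q) q′)))) (g-inj (trans (sym p) p′))))

  ge-inj : Injective _≡_ _≡_ (λ t → ec τ (g t) (g (next t)))
  ge-inj {t} {u} e with g⊆f t | g⊆f u
  ... | s , o | s′ , o′ with fe-inj (trans (onEdge o) (trans e (sym (onEdge o′))))
  ...   | refl = sameEdge o o′

colourful⇔rainbow : ∀ {A : AdjFn n} (τ : TotalColouring A 5) M {f} → Traverses A M f → Colourful τ f ⇔ Rainbow τ M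
colourful⇔rainbow τ M {f} f-traverses = mk⇔ (λ colourful → f , f-traverses , colourful)
  λ (g , g-traverses , colourful) → colourful-invariant τ {M} g-traverses f-traverses colourful

-- The graph Λ

odd : Fin 20 → Bool
odd v = toℕ v % 2 ≡ᵇ 1

-- v ~ v ± 1 (the Hamilton cycle), v ~ v ± 4 for even v (the pentagons), v ~ v ± 8 for odd v (the pentagrams)
Γ-neighbour : Fin 20 → Fin 4 → Fin 20
Γ-neighbour v k = (toℕ v + Vec.lookup (1 ∷ 19 ∷ chord ∷ 20 ∸ chord ∷ []) k) mod 20
  where chord = if odd v then 8 else 4

Γ-simple : IsSimple Γ
Γ-simple = decide (all? λ x → all? λ y → Γ x y Bool.≟ Γ y x) refl , decide (all? λ x → Γ x x Bool.≟ false) refl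

Γ-neighbours : ListsNeighbours Γ Γ-neighbour
Γ-neighbours = decide (all? λ x → all? λ y → (Γ x y Bool.≟ true) →-dec any? λ k → Γ-neighbour x k ≟ y) refl

voltage : AdjFn 20
voltage v w = odd v ∧ odd w

open Lift Γ voltage using (base; lift; liftNeighbour; lift-isDoubleCover; lift-listsNeighbours)

Λ : AdjFn 40
Λ = lift

Λ-neighbour : Fin 40 → Fin 4 → Fin 40
Λ-neighbour = liftNeighbour Γ-neighbour

Λ-neighbours : ListsNeighbours Λ Λ-neighbour
Λ-neighbours = lift-listsNeighbours Γ-neighbours

Λ-doubleCover : IsDoubleCover Λ Γ base
Λ-doubleCover = lift-isDoubleCover Γ-simple (λ v w → ∧-comm (odd v) (odd w))

Λ-regular : Regular Λ 4
Λ-regular = decide (all? λ x → count (Λ x) ℕ.≟ 4) refl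

Λ-no-3-cycle : ¬ HasCycle Λ 3
Λ-no-3-cycle = no-3-cycle Λ-neighbours (decide (all? (everyWalkFrom? Λ-neighbour 2 (noTriangleAt? Λ-neighbour))) refl)

Λ-no-4-cycle : ¬ HasCycle Λ 4
Λ-no-4-cycle = no-4-cycle Λ-neighbours (decide (all? (everyWalkFrom? Λ-neighbour 3 (noSquareAt? Λ-neighbour))) refl)

dodecahedralCopy : Bool → Bool → Vec (Fin 40) 20
dodecahedralCopy false false = # 0 ∷ # 1 ∷ # 29 ∷ # 28 ∷ # 24 ∷ # 20 ∷ # 21 ∷ # 9 ∷ # 8 ∷ # 4 ∷ # 16 ∷ # 33 ∷ # 17 ∷ # 32 ∷ # 25 ∷ # 36 ∷ # 13 ∷ # 37 ∷ # 12 ∷ # 5 ∷ []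
dodecahedralCopy false true  = # 0 ∷ # 4 ∷ # 3 ∷ # 35 ∷ # 36 ∷ # 20 ∷ # 24 ∷ # 23 ∷ # 15 ∷ # 16 ∷ # 19 ∷ # 8 ∷ # 31 ∷ # 7 ∷ # 32 ∷ # 39 ∷ # 28 ∷ # 11 ∷ # 27 ∷ # 12 ∷ []
dodecahedralCopy true  false = # 1 ∷ # 2 ∷ # 6 ∷ # 10 ∷ # 9 ∷ # 21 ∷ # 22 ∷ # 26 ∷ # 30 ∷ # 29 ∷ # 33 ∷ # 18 ∷ # 5 ∷ # 14 ∷ # 37 ∷ # 13 ∷ # 38 ∷ # 25 ∷ # 34 ∷ # 17 ∷ []
dodecahedralCopy true  true  = # 2 ∷ # 3 ∷ # 31 ∷ # 30 ∷ # 26 ∷ # 22 ∷ # 23 ∷ # 11 ∷ # 10 ∷ # 6 ∷ # 18 ∷ # 35 ∷ # 19 ∷ # 34 ∷ # 27 ∷ # 38 ∷ # 15 ∷ # 39 ∷ # 14 ∷ # 7 ∷ []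

Λ-preimages : ∀ i j → PreimageIso Λ base (petVerts i j) (petAdj i j) dodecahedron
Λ-preimages i j = φ i j , via i j
  where
  φ : Bool → Bool → Fin 20 → Fin 40
  φ i j = Vec.lookup (dodecahedralCopy i j)
  via? : ∀ i j → Dec (PreimageIsoVia Λ base (petVerts i j) (petAdj i j) dodecahedron (φ i j))
  via? i j = preimageIsoVia? Λ base (petVerts i j) (petAdj i j) dodecahedron (φ i j)
  via : ∀ i j → PreimageIsoVia Λ base (petVerts i j) (petAdj i j) dodecahedron (φ i j)
  via false false = decide (via? false false) refl
  via false true  = decide (via? false true) refl
  via true  false = decide (via? true false) refl
  via true  true  = decide (via? true true) refl

vertexColourTable : Vec (Fin 5) 40
vertexColourTable =
  # 3 ∷ # 0 ∷ # 1 ∷ # 3 ∷ # 4 ∷ # 1 ∷ # 2 ∷ # 4 ∷ # 0 ∷ # 2 ∷ # 3 ∷ # 0 ∷ # 1 ∷ # 3 ∷ # 4 ∷ # 1 ∷ # 2 ∷ # 4 ∷ # 0 ∷ # 2 ∷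
  # 0 ∷ # 4 ∷ # 3 ∷ # 2 ∷ # 1 ∷ # 0 ∷ # 4 ∷ # 3 ∷ # 2 ∷ # 1 ∷ # 0 ∷ # 4 ∷ # 3 ∷ # 2 ∷ # 1 ∷ # 0 ∷ # 4 ∷ # 3 ∷ # 2 ∷ # 1 ∷
  []

-- row x lists the colours of the edges from x to Λ-neighbour x 0, …, Λ-neighbour x 3
edgeColourTable : Vec (Vec (Fin 5) 4) 40
edgeColourTable =
  (# 4 ∷ # 0 ∷ # 2 ∷ # 1 ∷ []) ∷ (# 3 ∷ # 4 ∷ # 2 ∷ # 1 ∷ []) ∷ (# 2 ∷ # 3 ∷ # 0 ∷ # 4 ∷ []) ∷ (# 1 ∷ # 2 ∷ # 0 ∷ # 4 ∷ []) ∷ (# 0 ∷ # 1 ∷ # 3 ∷ # 2 ∷ []) ∷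
  (# 4 ∷ # 0 ∷ # 3 ∷ # 2 ∷ []) ∷ (# 3 ∷ # 4 ∷ # 1 ∷ # 0 ∷ []) ∷ (# 2 ∷ # 3 ∷ # 1 ∷ # 0 ∷ []) ∷ (# 1 ∷ # 2 ∷ # 4 ∷ # 3 ∷ []) ∷ (# 0 ∷ # 1 ∷ # 4 ∷ # 3 ∷ []) ∷
  (# 4 ∷ # 0 ∷ # 2 ∷ # 1 ∷ []) ∷ (# 3 ∷ # 4 ∷ # 2 ∷ # 1 ∷ []) ∷ (# 2 ∷ # 3 ∷ # 0 ∷ # 4 ∷ []) ∷ (# 1 ∷ # 2 ∷ # 0 ∷ # 4 ∷ []) ∷ (# 0 ∷ # 1 ∷ # 3 ∷ # 2 ∷ []) ∷
  (# 4 ∷ # 0 ∷ # 3 ∷ # 2 ∷ []) ∷ (# 3 ∷ # 4 ∷ # 1 ∷ # 0 ∷ []) ∷ (# 2 ∷ # 3 ∷ # 1 ∷ # 0 ∷ []) ∷ (# 1 ∷ # 2 ∷ # 4 ∷ # 3 ∷ []) ∷ (# 0 ∷ # 1 ∷ # 4 ∷ # 3 ∷ []) ∷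
  (# 1 ∷ # 4 ∷ # 3 ∷ # 2 ∷ []) ∷ (# 2 ∷ # 1 ∷ # 3 ∷ # 0 ∷ []) ∷ (# 4 ∷ # 2 ∷ # 1 ∷ # 0 ∷ []) ∷ (# 0 ∷ # 4 ∷ # 1 ∷ # 3 ∷ []) ∷ (# 2 ∷ # 0 ∷ # 4 ∷ # 3 ∷ []) ∷
  (# 3 ∷ # 2 ∷ # 4 ∷ # 1 ∷ []) ∷ (# 0 ∷ # 3 ∷ # 2 ∷ # 1 ∷ []) ∷ (# 1 ∷ # 0 ∷ # 2 ∷ # 4 ∷ []) ∷ (# 3 ∷ # 1 ∷ # 0 ∷ # 4 ∷ []) ∷ (# 4 ∷ # 3 ∷ # 0 ∷ # 2 ∷ []) ∷
  (# 1 ∷ # 4 ∷ # 3 ∷ # 2 ∷ []) ∷ (# 2 ∷ # 1 ∷ # 3 ∷ # 0 ∷ []) ∷ (# 4 ∷ # 2 ∷ # 1 ∷ # 0 ∷ []) ∷ (# 0 ∷ # 4 ∷ # 1 ∷ # 3 ∷ []) ∷ (# 2 ∷ # 0 ∷ # 4 ∷ # 3 ∷ []) ∷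
  (# 3 ∷ # 2 ∷ # 4 ∷ # 1 ∷ []) ∷ (# 0 ∷ # 3 ∷ # 2 ∷ # 1 ∷ []) ∷ (# 1 ∷ # 0 ∷ # 2 ∷ # 4 ∷ []) ∷ (# 3 ∷ # 1 ∷ # 0 ∷ # 4 ∷ []) ∷ (# 4 ∷ # 3 ∷ # 0 ∷ # 2 ∷ []) ∷
  []

vertexColour : Fin 40 → Fin 5
vertexColour = Vec.lookup vertexColourTable

-- pairs that are not adjacent get the irrelevant colour zero
edgeColour : Fin 40 → Fin 40 → Fin 5
edgeColour x y with any? (λ k → Λ-neighbour x k ≟ y)
... | yes (k , _) = Vec.lookup (Vec.lookup edgeColourTable x) k
... | no _        = zero

τ : TotalColouring Λ 5
τ = record
  { vc        = vertexColour
  ; ec        = edgeColour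
  ; ec-sym    = ∀-adjacent Λ-neighbours (decide (all? λ x → all? λ k →
                  edgeColour x (Λ-neighbour x k) ≟ edgeColour (Λ-neighbour x k) x) refl)
  ; v-proper  = ∀-adjacent Λ-neighbours (decide (all? λ x → all? λ k →
                  ¬? (vertexColour x ≟ vertexColour (Λ-neighbour x k))) refl)
  ; e-proper  = ∀-adjacent₂ Λ-neighbours (decide (all? λ x → all? λ k → all? λ l →
                  ¬? (Λ-neighbour x k ≟ Λ-neighbour x l) →-dec
                  ¬? (edgeColour x (Λ-neighbour x k) ≟ edgeColour x (Λ-neighbour x l))) refl)
  ; ve-proper = ∀-adjacent Λ-neighbours (decide (all? λ x → all? λ k →
                  ¬? (edgeColour x (Λ-neighbour x k) ≟ vertexColour x)) refl)
  }

-- the neighbours 16 and 19 of vertex 0 share colour 2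
τ-inefficient : ¬ Efficient τ
τ-inefficient (closed-nbhds-rainbow , _) = closed-nbhds-rainbow (# 0) (# 16) (# 19) (inj₂ refl) (inj₂ refl) (λ ()) refl

fiveCycleTable : Vec (Vec (Fin 40) 5) 64
fiveCycleTable =
  (# 0 ∷ # 1 ∷ # 2 ∷ # 3 ∷ # 4 ∷ []) ∷ (# 0 ∷ # 1 ∷ # 2 ∷ # 18 ∷ # 19 ∷ []) ∷ (# 0 ∷ # 1 ∷ # 29 ∷ # 17 ∷ # 16 ∷ []) ∷ (# 0 ∷ # 1 ∷ # 33 ∷ # 5 ∷ # 4 ∷ []) ∷
  (# 0 ∷ # 4 ∷ # 3 ∷ # 31 ∷ # 19 ∷ []) ∷ (# 0 ∷ # 4 ∷ # 8 ∷ # 12 ∷ # 16 ∷ []) ∷ (# 0 ∷ # 16 ∷ # 15 ∷ # 27 ∷ # 19 ∷ []) ∷ (# 0 ∷ # 16 ∷ # 17 ∷ # 18 ∷ # 19 ∷ []) ∷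
  (# 1 ∷ # 2 ∷ # 6 ∷ # 5 ∷ # 33 ∷ []) ∷ (# 1 ∷ # 2 ∷ # 18 ∷ # 17 ∷ # 29 ∷ []) ∷ (# 1 ∷ # 29 ∷ # 28 ∷ # 32 ∷ # 33 ∷ []) ∷ (# 1 ∷ # 29 ∷ # 30 ∷ # 34 ∷ # 33 ∷ []) ∷
  (# 2 ∷ # 3 ∷ # 4 ∷ # 5 ∷ # 6 ∷ []) ∷ (# 2 ∷ # 3 ∷ # 31 ∷ # 19 ∷ # 18 ∷ []) ∷ (# 2 ∷ # 3 ∷ # 35 ∷ # 7 ∷ # 6 ∷ []) ∷ (# 2 ∷ # 6 ∷ # 10 ∷ # 14 ∷ # 18 ∷ []) ∷
  (# 3 ∷ # 4 ∷ # 8 ∷ # 7 ∷ # 35 ∷ []) ∷ (# 3 ∷ # 31 ∷ # 30 ∷ # 34 ∷ # 35 ∷ []) ∷ (# 3 ∷ # 31 ∷ # 32 ∷ # 36 ∷ # 35 ∷ []) ∷ (# 4 ∷ # 5 ∷ # 6 ∷ # 7 ∷ # 8 ∷ []) ∷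
  (# 4 ∷ # 5 ∷ # 37 ∷ # 9 ∷ # 8 ∷ []) ∷ (# 5 ∷ # 6 ∷ # 10 ∷ # 9 ∷ # 37 ∷ []) ∷ (# 5 ∷ # 33 ∷ # 32 ∷ # 36 ∷ # 37 ∷ []) ∷ (# 5 ∷ # 33 ∷ # 34 ∷ # 38 ∷ # 37 ∷ []) ∷
  (# 6 ∷ # 7 ∷ # 8 ∷ # 9 ∷ # 10 ∷ []) ∷ (# 6 ∷ # 7 ∷ # 39 ∷ # 11 ∷ # 10 ∷ []) ∷ (# 7 ∷ # 8 ∷ # 12 ∷ # 11 ∷ # 39 ∷ []) ∷ (# 7 ∷ # 35 ∷ # 34 ∷ # 38 ∷ # 39 ∷ []) ∷
  (# 7 ∷ # 35 ∷ # 36 ∷ # 20 ∷ # 39 ∷ []) ∷ (# 8 ∷ # 9 ∷ # 10 ∷ # 11 ∷ # 12 ∷ []) ∷ (# 8 ∷ # 9 ∷ # 21 ∷ # 13 ∷ # 12 ∷ []) ∷ (# 9 ∷ # 10 ∷ # 14 ∷ # 13 ∷ # 21 ∷ []) ∷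
  (# 9 ∷ # 21 ∷ # 20 ∷ # 36 ∷ # 37 ∷ []) ∷ (# 9 ∷ # 21 ∷ # 22 ∷ # 38 ∷ # 37 ∷ []) ∷ (# 10 ∷ # 11 ∷ # 12 ∷ # 13 ∷ # 14 ∷ []) ∷ (# 10 ∷ # 11 ∷ # 23 ∷ # 15 ∷ # 14 ∷ []) ∷
  (# 11 ∷ # 12 ∷ # 16 ∷ # 15 ∷ # 23 ∷ []) ∷ (# 11 ∷ # 23 ∷ # 22 ∷ # 38 ∷ # 39 ∷ []) ∷ (# 11 ∷ # 23 ∷ # 24 ∷ # 20 ∷ # 39 ∷ []) ∷ (# 12 ∷ # 13 ∷ # 14 ∷ # 15 ∷ # 16 ∷ []) ∷
  (# 12 ∷ # 13 ∷ # 25 ∷ # 17 ∷ # 16 ∷ []) ∷ (# 13 ∷ # 14 ∷ # 18 ∷ # 17 ∷ # 25 ∷ []) ∷ (# 13 ∷ # 21 ∷ # 20 ∷ # 24 ∷ # 25 ∷ []) ∷ (# 13 ∷ # 21 ∷ # 22 ∷ # 26 ∷ # 25 ∷ []) ∷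
  (# 14 ∷ # 15 ∷ # 16 ∷ # 17 ∷ # 18 ∷ []) ∷ (# 14 ∷ # 15 ∷ # 27 ∷ # 19 ∷ # 18 ∷ []) ∷ (# 15 ∷ # 23 ∷ # 22 ∷ # 26 ∷ # 27 ∷ []) ∷ (# 15 ∷ # 23 ∷ # 24 ∷ # 28 ∷ # 27 ∷ []) ∷
  (# 17 ∷ # 25 ∷ # 24 ∷ # 28 ∷ # 29 ∷ []) ∷ (# 17 ∷ # 25 ∷ # 26 ∷ # 30 ∷ # 29 ∷ []) ∷ (# 19 ∷ # 27 ∷ # 26 ∷ # 30 ∷ # 31 ∷ []) ∷ (# 19 ∷ # 27 ∷ # 28 ∷ # 32 ∷ # 31 ∷ []) ∷
  (# 20 ∷ # 21 ∷ # 22 ∷ # 23 ∷ # 24 ∷ []) ∷ (# 20 ∷ # 21 ∷ # 22 ∷ # 38 ∷ # 39 ∷ []) ∷ (# 20 ∷ # 24 ∷ # 28 ∷ # 32 ∷ # 36 ∷ []) ∷ (# 20 ∷ # 36 ∷ # 37 ∷ # 38 ∷ # 39 ∷ []) ∷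
  (# 22 ∷ # 23 ∷ # 24 ∷ # 25 ∷ # 26 ∷ []) ∷ (# 22 ∷ # 26 ∷ # 30 ∷ # 34 ∷ # 38 ∷ []) ∷ (# 24 ∷ # 25 ∷ # 26 ∷ # 27 ∷ # 28 ∷ []) ∷ (# 26 ∷ # 27 ∷ # 28 ∷ # 29 ∷ # 30 ∷ []) ∷
  (# 28 ∷ # 29 ∷ # 30 ∷ # 31 ∷ # 32 ∷ []) ∷ (# 30 ∷ # 31 ∷ # 32 ∷ # 33 ∷ # 34 ∷ []) ∷ (# 32 ∷ # 33 ∷ # 34 ∷ # 35 ∷ # 36 ∷ []) ∷ (# 34 ∷ # 35 ∷ # 36 ∷ # 37 ∷ # 38 ∷ []) ∷
  []

fiveCycle : Fin 64 → Fin 5 → Fin 40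
fiveCycle k = Vec.lookup (Vec.lookup fiveCycleTable k)

fiveCycle-injective : ∀ k → Injective _≡_ _≡_ (fiveCycle k)
fiveCycle-injective = decide (all? λ k → injective? (fiveCycle k)) refl

fiveCycle-adjacent : ∀ k t → Λ (fiveCycle k t) (fiveCycle k (next t)) ≡ true
fiveCycle-adjacent = decide (all? λ k → all? λ t → Λ (fiveCycle k t) (fiveCycle k (next t)) Bool.≟ true) refl

fiveCycles-distinct : ∀ k l → EdgesWithin (fiveCycle k) (fiveCycle l) → k ≡ l
fiveCycles-distinct = decide (all? λ k → all? λ l → edgesWithin? (fiveCycle k) (fiveCycle l) →-dec (k ≟ l)) refl

closedFiveWalks-listed : ∀ x → EveryWalkFrom Λ-neighbour 4 (Listed Λ-neighbour fiveCycle) x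
closedFiveWalks-listed = decide (all? (everyWalkFrom? Λ-neighbour 4 (listed? Λ-neighbour fiveCycle))) refl

open FiveCycleTable Λ-neighbours fiveCycle-injective fiveCycle-adjacent fiveCycles-distinct closedFiveWalks-listed
  using (fiveCycles; cycle-traverses)

Λ-girth : Girth Λ 5
Λ-girth = girth-5 {A = Λ} (fiveCycle (# 0) , fiveCycle-injective (# 0) , fiveCycle-adjacent (# 0)) Λ-no-3-cycle Λ-no-4-cycle

fiveCycle-colourful⇔rainbow : ∀ k → Colourful τ (fiveCycle k) ⇔ Rainbow τ (edgeSet (fiveCycle k))
fiveCycle-colourful⇔rainbow k = colourful⇔rainbow τ (edgeSet (fiveCycle k)) (cycle-traverses k)

rainbowFiveCycles : ExactlyN (λ M → IsFiveCycle Λ M × Rainbow τ M) 24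
rainbowFiveCycles =
  ExactlyN-∩ fiveCycles (ExactlyN-⇔ fiveCycle-colourful⇔rainbow (ExactlyN-filter (colourful? τ ∘ fiveCycle)))

nonRainbowFiveCycles : ExactlyN (λ M → IsFiveCycle Λ M × ¬ Rainbow τ M) 40
nonRainbowFiveCycles =
  ExactlyN-∩ fiveCycles (ExactlyN-⇔ (¬-cong-⇔ ∘ fiveCycle-colourful⇔rainbow) (ExactlyN-filter (¬? ∘ colourful? τ ∘ fiveCycle)))

proposition36 :
    Σ (AdjFn 40) λ L → Σ (Fin 40 → Fin 20) λ p →
      IsDoubleCover L Γ p
      × (∀ (i j : Bool) → PreimageIso L p (petVerts i j) (petAdj i j) dodecahedron)
      × Regular L 4
      × Girth L 5
      × ExactlyN (IsFiveCycle L) 64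
      × Σ (TotalColouring L 5) λ τ →
          ¬ Efficient τ
          × ExactlyN (λ M → IsFiveCycle L M × Rainbow τ M) 24
          × ExactlyN (λ M → IsFiveCycle L M × ¬ Rainbow τ M) 40
proposition36 =
  Λ , base , Λ-doubleCover , Λ-preimages , Λ-regular , Λ-girth , fiveCycles ,
  τ , τ-inefficient , rainbowFiveCycles , nonRainbowFiveCycles
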